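{- Let $\mathbb{A}=(a_{i_1\cdots i_m})$ be a nonnegative tensor of order $m\ge2$ and dimension $n$ such that, for every $i\in[n]$, $a_{ii_2\cdots i_m}=0$ unless $i_2=i_3=\cdots=i_m$. Then for every $j\in[n]$ and every positive integer $k$, $S_k(\mathbb{A},j)=S_k(M(\mathbb{A}),j)$.
   Context: Tensors of order $m$ and dimension $n$ are arrays indexed by $[n]^m$, $[n]=\{1,\dots,n\}$. For a dimension-$n$ tensor $\mathbb{A}$ of order $m\ge2$ and a dimension-$n$ tensor $\mathbb{B}$ of order $p\ge1$, the product $\mathbb{A}\mathbb{B}$ is the dimension-$n$ tensor $\mathbb{D}$ of order $(m-1)(p-1)+1$ with $d_{i\alpha_1\cdots\alpha_{m-1}}=\sum_{i_2,\dots,i_m=1}^n a_{ii_2\cdots i_m}b_{i_2\alpha_1}\cdots b_{i_m\alpha_{m-1}}$ ($i\in[n]$, $\alpha_t\in[n]^{p-1}$). Powers: $\mathbb{A}^1=\mathbb{A}$, $\mathbb{A}^{k+1}=\mathbb{A}\mathbb{A}^k$. The majorization matrix $M(\mathbb{B})$ of a dimension-$n$ tensor $\mathbb{B}$ of order $\ge2$ is the $n\times n$ matrix with $(M(\mathbb{B}))_{ij}=b_{ij\cdots j}$. For the tensor, $S_k(\mathbb{A},j)=\{u\in[n]\mid (M(\mathbb{A}^k))_{uj}>0\}$; for a nonnegative $n\times n$ matrix $A$, $S_k(A,j)=\{u\in[n]\mid (A^k)_{uj}>0\}$ (ordinary matrix power).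
   Formalization: The nonnegative tensor $\mathbb{A}$ has its entries in ℚ. -}

module Defs where

open import Data.Nat using (ℕ; zero; suc; _*_; _+_; NonZero)
open import Data.Fin using (Fin; _≟_)
open import Relation.Nullary using (yes; no)
open import Data.Vec using (Vec; []; _∷_; splitAt; replicate; lookup)
open import Data.Product using (proj₁; proj₂)
open import Data.Rational using (ℚ; 0ℚ; 1ℚ; _<_; _≤_) renaming (_+_ to _+ℚ_; _*_ to _*ℚ_)
open import Relation.Binary.PropositionalEquality using (_≡_)

Tensor : ℕ → ℕ → Set
Tensor n m = Vec (Fin n) m → ℚ

Nonneg : ∀ {n m} → Tensor n m → Set
Nonneg A = ∀ v → 0ℚ ≤ A v

sumFin : (n : ℕ) → (Fin n → ℚ) → ℚ
sumFin zero    f = 0ℚ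
sumFin (suc n) f = f Fin.zero +ℚ sumFin n (λ i → f (Fin.suc i))

sumVec : (n k : ℕ) → (Vec (Fin n) k → ℚ) → ℚ
sumVec n zero    f = f []
sumVec n (suc k) f = sumFin n (λ i → sumVec n k (λ v → f (i ∷ v)))

blocks : ∀ {A : Set} (q p : ℕ) → Vec A (q * p) → Vec (Vec A p) q
blocks zero    p v = []
blocks (suc q) p v = proj₁ (splitAt p v) ∷ blocks q p (proj₁ (proj₂ (splitAt p v)))

prodBlocks : ∀ {n p q} → Tensor n (suc p) → Vec (Fin n) q → Vec (Vec (Fin n) p) q → ℚ
prodBlocks B []       []       = 1ℚ
prodBlocks B (i ∷ is) (α ∷ αs) = B (i ∷ α) *ℚ prodBlocks B is αs

-- Product AB of A (order m = m'+1) and B (order p = p'+1): order m'*p' + 1,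
-- d_{i α_1 … α_{m-1}} = Σ_{i_2..i_m} a_{i i_2 … i_m} b_{i_2 α_1} ⋯ b_{i_m α_{m-1}}
tmul : ∀ {n m' p'} → Tensor n (suc m') → Tensor n (suc p') → Tensor n (suc (m' * p'))
tmul {n} {m'} {p'} A B (i ∷ β) =
  sumVec n m' (λ is → A (i ∷ is) *ℚ prodBlocks B is (blocks m' p' β))

-- (order of A^k) - 1, for A of order m'+1 and k ≥ 1
ord : ℕ → ℕ → ℕ
ord m' zero          = 0   -- unused (k = 0)
ord m' (suc zero)    = m'
ord m' (suc (suc k)) = m' * ord m' (suc k)

tpow : ∀ {n m'} → Tensor n (suc m') → (k : ℕ) → .{{NonZero k}} → Tensor n (suc (ord m' k))
tpow A (suc zero)          = A
tpow A (suc (suc k))       = tmul A (tpow A (suc k))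

Matrix : ℕ → Set
Matrix n = Fin n → Fin n → ℚ

majorization : ∀ {n p} → Tensor n (suc p) → Matrix n
majorization {p = p} B i j = B (i ∷ replicate p j)

matMul : ∀ {n} → Matrix n → Matrix n → Matrix n
matMul {n} A B i j = sumFin n (λ l → A i l *ℚ B l j)

identity : ∀ {n} → Matrix n
identity i j with i ≟ j
... | yes _ = 1ℚ
... | no  _ = 0ℚ

matPow : ∀ {n} → Matrix n → ℕ → Matrix n
matPow A zero    = identity
matPow A (suc k) = matMul A (matPow A k)

-- S_k(𝔸, j) = { u | M(𝔸^k)_{uj} > 0 }   (as a predicate on [n], k ≥ 1)
S-tensor : ∀ {n m'} → Tensor n (suc m') → (k : ℕ) → .{{NonZero k}} → Fin n → Fin n → Set
S-tensor A k j u = 0ℚ < majorization (tpow A k) u j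

S-matrix : ∀ {n} → Matrix n → ℕ → Fin n → Fin n → Set
S-matrix A k j u = 0ℚ < matPow A k u j

AllEqual : ∀ {n k} → Vec (Fin n) k → Set
AllEqual v = ∀ s t → lookup v s ≡ lookup v t

-- Entries of products of nonnegative tensors are sums of products of nonnegative numbers,
-- so only their positivity pattern matters: a sum is positive iff some summand is, a
-- product iff every factor is. If a_{i i₂…iₘ} vanishes unless i₂ = ⋯ = iₘ, the only
-- summands of (𝔸𝔹)_{u j…j} that can be positive are those with i₂ = ⋯ = iₘ = l, equal to
-- a_{u l…l} (b_{l j…j})^{m-1}. Hence M(𝔸𝔹)_{uj} > 0 iff M(𝔸)_{ul} > 0 and M(𝔹)_{lj} > 0
-- for some l, which is the positivity pattern of M(𝔸) M(𝔹); induct on k.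

module Submission where

open import Defs
open import Data.Nat using (ℕ; zero; suc; _*_; _+_; _≤_; NonZero; s≤s; z≤n)
open import Data.Fin using (Fin; zero; suc; _≟_)
open import Data.Vec using (Vec; []; _∷_; replicate; lookup; take; drop)
open import Data.Product using (∃; _×_; _,_; proj₁)
open import Data.Product.Function.Dependent.Propositional using (Σ-⇔)
open import Data.Product.Function.NonDependent.Propositional using (_×-⇔_)
open import Data.Sum using (_⊎_; inj₁; inj₂)
open import Data.Empty using (⊥-elim)
open import Data.Rational using (ℚ; 0ℚ; 1ℚ; _<_; _<?_; positive; nonNegative)
  renaming (_≤_ to _≤ℚ_; _+_ to _+ℚ_; _*_ to _*ℚ_)
open import Data.Rational.Properties as ℚ
  using (≤-refl; <⇒≤; <-irrefl; ≮⇒≥; +-monoˡ-≤; +-identityˡ; *-zeroˡ; *-zeroʳ;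
         *-cancelʳ-<-nonNeg; *-cancelˡ-<-nonNeg; positive⁻¹; nonNegative⁻¹;
         nonNeg+nonNeg⇒nonNeg; pos+nonNeg⇒pos; nonNeg+pos⇒pos; nonNeg*nonNeg⇒nonNeg; pos*pos⇒pos)
open import Relation.Nullary using (¬_; yes; no)
open import Relation.Nullary.Decidable using (decidable-stable)
open import Relation.Binary.PropositionalEquality using (_≡_; refl; sym; cong; cong₂; subst; module ≡-Reasoning)
open import Function.Base using (_∘_)
open import Function.Bundles using (_⇔_; mk⇔; Equivalence)
open import Function.Construct.Identity using (↠-id)
open import Function.Properties.Equivalence using () renaming (refl to ⇔-refl; sym to ⇔-sym; trans to ⇔-trans)
open import Function.Related.Propositional using (module EquationalReasoning)

module _ {a b : ℚ} where

  +-nonNeg : 0ℚ ≤ℚ a → 0ℚ ≤ℚ b → 0ℚ ≤ℚ a +ℚ b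
  +-nonNeg a≥0 b≥0 = nonNegative⁻¹ _ {{nonNeg+nonNeg⇒nonNeg a {{nonNegative a≥0}} b {{nonNegative b≥0}}}}

  *-nonNeg : 0ℚ ≤ℚ a → 0ℚ ≤ℚ b → 0ℚ ≤ℚ a *ℚ b
  *-nonNeg a≥0 b≥0 = nonNegative⁻¹ _ {{nonNeg*nonNeg⇒nonNeg a {{nonNegative a≥0}} b {{nonNegative b≥0}}}}

  +-pos⇔ : 0ℚ ≤ℚ a → 0ℚ ≤ℚ b → (0ℚ < a +ℚ b ⇔ (0ℚ < a ⊎ 0ℚ < b))
  +-pos⇔ a≥0 b≥0 = mk⇔ to from
    where
    to : 0ℚ < a +ℚ b → 0ℚ < a ⊎ 0ℚ < b
    to sum>0 with 0ℚ <? a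
    ... | yes a>0 = inj₁ a>0
    ... | no  a≯0 = inj₂ (begin-strict
      0ℚ         <⟨ sum>0 ⟩
      a +ℚ b     ≤⟨ +-monoˡ-≤ b (≮⇒≥ a≯0) ⟩
      0ℚ +ℚ b    ≡⟨ +-identityˡ b ⟩
      b          ∎)
      where open ℚ.≤-Reasoning
    from : 0ℚ < a ⊎ 0ℚ < b → 0ℚ < a +ℚ b
    from (inj₁ a>0) = positive⁻¹ _ {{pos+nonNeg⇒pos a {{positive a>0}} b {{nonNegative b≥0}}}}
    from (inj₂ b>0) = positive⁻¹ _ {{nonNeg+pos⇒pos a {{nonNegative a≥0}} b {{positive b>0}}}}

  *-pos⇔ : 0ℚ ≤ℚ a → 0ℚ ≤ℚ b → (0ℚ < a *ℚ b ⇔ (0ℚ < a × 0ℚ < b))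
  *-pos⇔ a≥0 b≥0 = mk⇔
    (λ ab>0 → *-cancelʳ-<-nonNeg b {{nonNegative b≥0}} (subst (_< a *ℚ b) (sym (*-zeroˡ b)) ab>0)
            , *-cancelˡ-<-nonNeg a {{nonNegative a≥0}} (subst (_< a *ℚ b) (sym (*-zeroʳ a)) ab>0))
    (λ (a>0 , b>0) → positive⁻¹ _ {{pos*pos⇒pos a {{positive a>0}} b {{positive b>0}}}})

sumFin-nonNeg : ∀ n {f : Fin n → ℚ} → (∀ i → 0ℚ ≤ℚ f i) → 0ℚ ≤ℚ sumFin n f
sumFin-nonNeg zero    f≥0 = ≤-refl
sumFin-nonNeg (suc n) f≥0 = +-nonNeg (f≥0 zero) (sumFin-nonNeg n (f≥0 ∘ suc))

sumFin-pos⇔ : ∀ n {f : Fin n → ℚ} → (∀ i → 0ℚ ≤ℚ f i) → (0ℚ < sumFin n f ⇔ ∃ λ i → 0ℚ < f i)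
sumFin-pos⇔ zero    f≥0 = mk⇔ (λ 0<0 → ⊥-elim (<-irrefl refl 0<0)) (λ ())
sumFin-pos⇔ (suc n) f≥0 = ⇔-trans (+-pos⇔ (f≥0 zero) (sumFin-nonNeg n (f≥0 ∘ suc))) (mk⇔ to from)
  where
  rest⇔ = sumFin-pos⇔ n (f≥0 ∘ suc)
  to : _ ⊎ _ → ∃ _
  to (inj₁ f₀>0)   = zero , f₀>0
  to (inj₂ rest>0) = let (i , fᵢ>0) = Equivalence.to rest⇔ rest>0 in suc i , fᵢ>0
  from : ∃ _ → _ ⊎ _
  from (zero  , f₀>0) = inj₁ f₀>0
  from (suc i , fᵢ>0) = inj₂ (Equivalence.from rest⇔ (i , fᵢ>0))

sumVec-nonNeg : ∀ n k {f : Vec (Fin n) k → ℚ} → (∀ v → 0ℚ ≤ℚ f v) → 0ℚ ≤ℚ sumVec n k f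
sumVec-nonNeg n zero    f≥0 = f≥0 []
sumVec-nonNeg n (suc k) f≥0 = sumFin-nonNeg n (λ i → sumVec-nonNeg n k (f≥0 ∘ (i ∷_)))

sumVec-pos⇔ : ∀ n k {f : Vec (Fin n) k → ℚ} → (∀ v → 0ℚ ≤ℚ f v) → (0ℚ < sumVec n k f ⇔ ∃ λ v → 0ℚ < f v)
sumVec-pos⇔ n zero    f≥0 = mk⇔ ([] ,_) λ { ([] , f[]>0) → f[]>0 }
sumVec-pos⇔ n (suc k) f≥0 =
  ⇔-trans (sumFin-pos⇔ n (λ i → sumVec-nonNeg n k (f≥0 ∘ (i ∷_)))) (mk⇔ to from)
  where
  tail⇔ = λ i → sumVec-pos⇔ n k (f≥0 ∘ (i ∷_))
  to : ∃ _ → ∃ _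
  to (i , tail>0) = let (v , fᵢᵥ>0) = Equivalence.to (tail⇔ i) tail>0 in i ∷ v , fᵢᵥ>0
  from : ∃ _ → ∃ _
  from (i ∷ v , fᵢᵥ>0) = i , Equivalence.from (tail⇔ i) (v , fᵢᵥ>0)

take-replicate : ∀ {A : Set} p {r} (x : A) → take p (replicate (p + r) x) ≡ replicate p x
take-replicate zero    x = refl
take-replicate (suc p) x = cong (x ∷_) (take-replicate p x)

drop-replicate : ∀ {A : Set} p {r} (x : A) → drop p (replicate (p + r) x) ≡ replicate r x
drop-replicate zero    x = refl
drop-replicate (suc p) x = drop-replicate p x

blocks-replicate : ∀ {A : Set} q p (x : A) → blocks q p (replicate (q * p) x) ≡ replicate q (replicate p x)
blocks-replicate zero    p x = refl
blocks-replicate (suc q) p x = cong₂ _∷_ (take-replicate p x) (begin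
  blocks q p (drop p (replicate (p + q * p) x)) ≡⟨ cong (blocks q p) (drop-replicate p x) ⟩
  blocks q p (replicate (q * p) x)              ≡⟨ blocks-replicate q p x ⟩
  replicate q (replicate p x)                   ∎)
  where open ≡-Reasoning

AllEqual⇒≡replicate : ∀ {n k} {x : Fin n} {xs : Vec (Fin n) k} → AllEqual (x ∷ xs) → x ∷ xs ≡ replicate (suc k) x
AllEqual⇒≡replicate {n} {x = x} all= = ≡replicate (λ s → all= s zero)
  where
  ≡replicate : ∀ {k} {v : Vec (Fin n) k} → (∀ s → lookup v s ≡ x) → v ≡ replicate k x
  ≡replicate {v = []}    _   = refl
  ≡replicate {v = y ∷ v} v≡x = cong₂ _∷_ (v≡x zero) (≡replicate (v≡x ∘ suc))

prodBlocks-nonNeg : ∀ {n p q} {B : Tensor n (suc p)} → Nonneg B →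
  (is : Vec (Fin n) q) (αs : Vec (Vec (Fin n) p) q) → 0ℚ ≤ℚ prodBlocks B is αs
prodBlocks-nonNeg B≥0 []       []       = <⇒≤ (positive⁻¹ 1ℚ)
prodBlocks-nonNeg B≥0 (i ∷ is) (α ∷ αs) = *-nonNeg (B≥0 (i ∷ α)) (prodBlocks-nonNeg B≥0 is αs)

prodBlocks-replicate-pos⇔ : ∀ {n p} {B : Tensor n (suc p)} → Nonneg B → ∀ q l α →
  (0ℚ < prodBlocks B (replicate (suc q) l) (replicate (suc q) α) ⇔ 0ℚ < B (l ∷ α))
prodBlocks-replicate-pos⇔ {B = B} B≥0 q l α =
  mk⇔ (proj₁ ∘ Equivalence.to (factors q)) (λ B>0 → Equivalence.from (factors q) (B>0 , power>0 B>0 q))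
  where
  factors : ∀ q → (0ℚ < prodBlocks B (replicate (suc q) l) (replicate (suc q) α)
                    ⇔ (0ℚ < B (l ∷ α) × 0ℚ < prodBlocks B (replicate q l) (replicate q α)))
  factors q = *-pos⇔ (B≥0 (l ∷ α)) (prodBlocks-nonNeg B≥0 (replicate q l) (replicate q α))
  power>0 : 0ℚ < B (l ∷ α) → ∀ q → 0ℚ < prodBlocks B (replicate q l) (replicate q α)
  power>0 B>0 zero    = positive⁻¹ 1ℚ
  power>0 B>0 (suc q) = Equivalence.from (factors q) (B>0 , power>0 B>0 q)

tmul-nonNeg : ∀ {n m p} {A : Tensor n (suc m)} {B : Tensor n (suc p)} → Nonneg A → Nonneg B → Nonneg (tmul A B)
tmul-nonNeg {n} {m} A≥0 B≥0 (i ∷ β) = sumVec-nonNeg n m (λ is → *-nonNeg (A≥0 (i ∷ is)) (prodBlocks-nonNeg B≥0 is _))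

tpow-nonNeg : ∀ {n m} {A : Tensor n (suc m)} → Nonneg A → ∀ k .{{_ : NonZero k}} → Nonneg (tpow A k)
tpow-nonNeg A≥0 (suc zero)    = A≥0
tpow-nonNeg A≥0 (suc (suc k)) = tmul-nonNeg A≥0 (tpow-nonNeg A≥0 (suc k))

OffDiagonalZero : ∀ {n m} → Tensor n (suc m) → Set
OffDiagonalZero {n} {m} A = ∀ (i : Fin n) (is : Vec (Fin n) m) → ¬ AllEqual is → A (i ∷ is) ≡ 0ℚ

positive⇒AllEqual : ∀ {n m} {A : Tensor n (suc m)} → OffDiagonalZero A → ∀ {i is} → 0ℚ < A (i ∷ is) → AllEqual is
positive⇒AllEqual A-off {i} {is} A>0 s t =
  decidable-stable (lookup is s ≟ lookup is t) (λ s≢t → <-irrefl (sym (A-off i is (λ all= → s≢t (all= s t)))) A>0)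

majorization-tmul-pos⇔ : ∀ {n m p} {A : Tensor n (suc (suc m))} {B : Tensor n (suc p)} →
  Nonneg A → Nonneg B → OffDiagonalZero A → ∀ u j →
  (0ℚ < majorization (tmul A B) u j ⇔ ∃ λ l → 0ℚ < majorization A u l × 0ℚ < majorization B l j)
majorization-tmul-pos⇔ {n} {m} {p} {A} {B} A≥0 B≥0 A-off u j = begin
  0ℚ < majorization (tmul A B) u j      ≡⟨ cong (λ αs → 0ℚ < sumVec n (suc m) (term αs)) (blocks-replicate (suc m) p j) ⟩
  0ℚ < sumVec n (suc m) (term jᵖ…jᵖ)    ∼⟨ sumVec-pos⇔ n (suc m) (term≥0 jᵖ…jᵖ) ⟩
  (∃ λ is → 0ℚ < term jᵖ…jᵖ is)         ∼⟨ mk⇔ to from ⟩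
  (∃ λ l → 0ℚ < A (u ∷ replicate (suc m) l) × 0ℚ < B (l ∷ jᵖ)) ∎
  where
  open EquationalReasoning
  jᵖ = replicate p j
  jᵖ…jᵖ = replicate (suc m) jᵖ
  term : Vec (Vec (Fin n) p) (suc m) → Vec (Fin n) (suc m) → ℚ
  term αs is = A (u ∷ is) *ℚ prodBlocks B is αs
  term≥0 : ∀ αs is → 0ℚ ≤ℚ term αs is
  term≥0 αs is = *-nonNeg (A≥0 (u ∷ is)) (prodBlocks-nonNeg B≥0 is αs)
  factors : ∀ is → (0ℚ < term jᵖ…jᵖ is ⇔ (0ℚ < A (u ∷ is) × 0ℚ < prodBlocks B is jᵖ…jᵖ))
  factors is = *-pos⇔ (A≥0 (u ∷ is)) (prodBlocks-nonNeg B≥0 is jᵖ…jᵖ)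
  B-factor⇔ : ∀ l → (0ℚ < prodBlocks B (replicate (suc m) l) jᵖ…jᵖ ⇔ 0ℚ < B (l ∷ jᵖ))
  B-factor⇔ l = prodBlocks-replicate-pos⇔ B≥0 m l jᵖ
  to : (∃ λ is → 0ℚ < term jᵖ…jᵖ is) → ∃ λ l → 0ℚ < A (u ∷ replicate (suc m) l) × 0ℚ < B (l ∷ jᵖ)
  to (l ∷ ls , term>0) with Equivalence.to (factors (l ∷ ls)) term>0
  ... | A>0 , prod>0 with AllEqual⇒≡replicate (positive⇒AllEqual {A = A} A-off A>0)
  ...   | refl = l , A>0 , Equivalence.to (B-factor⇔ l) prod>0
  from : (∃ λ l → 0ℚ < A (u ∷ replicate (suc m) l) × 0ℚ < B (l ∷ jᵖ)) → ∃ λ is → 0ℚ < term jᵖ…jᵖ is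
  from (l , A>0 , B>0) = replicate (suc m) l , Equivalence.from (factors _) (A>0 , Equivalence.from (B-factor⇔ l) B>0)

NonnegMatrix : ∀ {n} → Matrix n → Set
NonnegMatrix M = ∀ i j → 0ℚ ≤ℚ M i j

majorization-nonNeg : ∀ {n p} {B : Tensor n (suc p)} → Nonneg B → NonnegMatrix (majorization B)
majorization-nonNeg B≥0 i j = B≥0 _

identity-nonNeg : ∀ {n} → NonnegMatrix {n} identity
identity-nonNeg i j with i ≟ j
... | yes _ = <⇒≤ (positive⁻¹ 1ℚ)
... | no  _ = ≤-refl

identity-pos⇔ : ∀ {n} (i j : Fin n) → (0ℚ < identity i j ⇔ i ≡ j)
identity-pos⇔ i j with i ≟ j
... | yes i≡j = mk⇔ (λ _ → i≡j) (λ _ → positive⁻¹ 1ℚ)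
... | no  i≢j = mk⇔ (λ 0<0 → ⊥-elim (<-irrefl refl 0<0)) (λ i≡j → ⊥-elim (i≢j i≡j))

matMul-pos⇔ : ∀ {n} {M X : Matrix n} → NonnegMatrix M → NonnegMatrix X → ∀ u j →
  (0ℚ < matMul M X u j ⇔ ∃ λ l → 0ℚ < M u l × 0ℚ < X l j)
matMul-pos⇔ {n} M≥0 X≥0 u j =
  ⇔-trans (sumFin-pos⇔ n (λ l → *-nonNeg (M≥0 u l) (X≥0 l j))) (Σ-⇔ (↠-id _) (*-pos⇔ (M≥0 u _) (X≥0 _ j)))

matMul-identityʳ-pos⇔ : ∀ {n} {M : Matrix n} → NonnegMatrix M → ∀ u j → (0ℚ < matMul M identity u j ⇔ 0ℚ < M u j)
matMul-identityʳ-pos⇔ {M = M} M≥0 u j = ⇔-trans (matMul-pos⇔ M≥0 identity-nonNeg u j) (mk⇔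
  (λ (l , M>0 , I>0) → subst (λ l → 0ℚ < M u l) (Equivalence.to (identity-pos⇔ l j) I>0) M>0)
  (λ M>0 → j , M>0 , Equivalence.from (identity-pos⇔ j j) refl))

matPow-nonNeg : ∀ {n} {M : Matrix n} → NonnegMatrix M → ∀ k → NonnegMatrix (matPow M k)
matPow-nonNeg M≥0 zero    = identity-nonNeg
matPow-nonNeg M≥0 (suc k) i j = sumFin-nonNeg _ (λ l → *-nonNeg (M≥0 i l) (matPow-nonNeg M≥0 k l j))

lemma4p2 : ∀ {n m'} → 1 ≤ m' → (A : Tensor n (suc m')) → Nonneg A →
    (∀ (i : Fin n) (is : Vec (Fin n) m') → ¬ AllEqual is → A (i ∷ is) ≡ 0ℚ) →
    ∀ (j : Fin n) (k : ℕ) .{{_ : NonZero k}} (u : Fin n) →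
    S-tensor A k j u ⇔ S-matrix (majorization A) k j u
lemma4p2 {m' = suc m} (s≤s z≤n) A A≥0 A-off j = S⇔S
  where
  M = majorization A
  M≥0 = majorization-nonNeg A≥0
  S⇔S : ∀ k .{{_ : NonZero k}} u → S-tensor A k j u ⇔ S-matrix M k j u
  S⇔S (suc zero)    u = ⇔-sym (matMul-identityʳ-pos⇔ M≥0 u j)
  S⇔S (suc (suc k)) u = begin
    S-tensor A (2 + k) j u                              ∼⟨ majorization-tmul-pos⇔ A≥0 (tpow-nonNeg A≥0 (suc k)) A-off u j ⟩
    (∃ λ l → 0ℚ < M u l × S-tensor A (suc k) j l)     ∼⟨ Σ-⇔ (↠-id _) (⇔-refl ×-⇔ S⇔S (suc k) _) ⟩
    (∃ λ l → 0ℚ < M u l × S-matrix M (suc k) j l)     ∼⟨ ⇔-sym (matMul-pos⇔ M≥0 (matPow-nonNeg M≥0 (suc k)) u j) ⟩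
    S-matrix M (2 + k) j u                              ∎
    where open EquationalReasoning
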